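{- Let $(s_i)_{i\ge1}$ and $(t_i)_{i\ge 1}$ be sequences of positive integers with $t_i<s_i$ for all $i$, and let $n\ge 1$. Then the number $\mathcal{B}_{\vec s,\vec t}(n)$ of possible sets of balls on the lawn after $n$ turns of the $(\vec s,\vec t)$-tennis ball problem equals $\lvert \mathrm{SVT}((n+1)^2,\rho)\rvert$, where $\rho$ is the density on the two-row shape with both rows of length $n+1$ given by $\rho_{1,1}=1$, $\rho_{1,j+1}=t_j$ for $1\le j\le n$, $\rho_{2,j}=s_j-t_j$ for $1\le j\le n$, and $\rho_{2,n+1}=1$.
   Context: The $(\vec s,\vec t)$-tennis ball problem: balls are labelled by positive integers and one starts holding no balls. Let $S_i=s_1+\dots+s_i$ ($S_0=0$). On turn $i$, the balls labelled $S_{i-1}+1,\dots,S_i$ are added to the balls currently held, and then some $t_i$ of the held balls are chosen and thrown onto the lawn (and are no longer held). $\mathcal{B}_{\vec s,\vec t}(n)$ is the number of distinct sets of balls that can be on the lawn after $n$ turns. Cell $(i,j)$ is in row $i$, column $j$. For a density $\rho$ of nonnegative integers $\rho_{i,j}$ with $N=\sum\rho_{i,j}$, a standard set-valued Young tableau of shape $\lambda$ and density $\rho$ is an assignment to each cell $(i,j)$ of a set of exactly $\rho_{i,j}$ integers, these sets partitioning $\{1,\dots,N\}$, such that every integer in cell $(i,j)$ is smaller than every integer in cells $(i,j+1)$ and $(i+1,j)$ when these exist; $\mathrm{SVT}(\lambda,\rho)$ is the set of such tableaux. -}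

module Defs where

open import Data.Nat using (ℕ; zero; suc; _+_; _∸_; _≤_; _<_)
open import Data.Nat.Properties using (_≟_)
open import Data.Fin using (Fin; toℕ; inject₁) renaming (_<_ to _<ᶠ_; zero to fzero; suc to fsuc)
open import Data.Fin.Subset using (Subset; ∣_∣) renaming (_∈_ to _∈ˢ_)
open import Data.Vec using (Vec; lookup; tabulate; sum)
open import Data.List using (List; length)
open import Data.List.Membership.Propositional using (_∈_)
open import Data.List.Relation.Unary.Unique.Propositional using (Unique)
open import Data.Product using (Σ; ∃; _×_; _,_)
open import Relation.Binary.PropositionalEquality using (_≡_; _≢_)
open import Relation.Nullary using (¬_; yes; no)
open import Function.Bundles using (_⇔_)

HasCard : {A : Set} → (A → Set) → ℕ → Set
HasCard {A} P k =
  Σ (List A) λ xs → Unique xs × (∀ x → (x ∈ xs) ⇔ P x) × length xs ≡ k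

-- Tennis ball problem.  Sequences s, t : ℕ → ℕ are indexed from 1
-- (the values at 0 are irrelevant).  Balls are positive integers.

S : (ℕ → ℕ) → ℕ → ℕ
S s zero    = zero
S s (suc i) = S s i + s (suc i)

-- A run of n turns: Thrown i is the list of balls thrown on turn i.
-- On turn i the held balls are {1,…,S i} minus the balls thrown on
-- earlier turns; exactly t i distinct held balls are thrown.
ValidRun : (s t : ℕ → ℕ) (n : ℕ) → (ℕ → List ℕ) → Set
ValidRun s t n Thrown =
  ∀ i → 1 ≤ i → i ≤ n →
    Unique (Thrown i) × length (Thrown i) ≡ t i ×
    (∀ b → b ∈ Thrown i →
       (1 ≤ b × b ≤ S s i) × (∀ j → 1 ≤ j → j < i → ¬ (b ∈ Thrown j)))

-- A subset L of {1,…,S n} (ball b ↔ index b-1 : Fin (S n)) is a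
-- possible lawn set after n turns.
PossibleLawn : (s t : ℕ → ℕ) (n : ℕ) → Subset (S s n) → Set
PossibleLawn s t n L =
  ∃ λ (Thrown : ℕ → List ℕ) → ValidRun s t n Thrown ×
    (∀ (x : Fin (S s n)) →
      (x ∈ˢ L) ⇔ (∃ λ i → 1 ≤ i × i ≤ n × suc (toℕ x) ∈ Thrown i))

TennisCount : (s t : ℕ → ℕ) (n k : ℕ) → Set
TennisCount s t n k = HasCard (PossibleLawn s t n) k

-- Rows and columns are 0-indexed: cell (r , c) here is
-- cell (r+1 , c+1) of the paper.  The integers {1,…,N} are represented
-- by Fin N (k ↔ k+1, order-preserving).

ρ : (s t : ℕ → ℕ) (n : ℕ) → Fin 2 → Fin (suc n) → ℕ
ρ s t n fzero fzero = 1
ρ s t n fzero (fsuc j) = t (suc (toℕ j))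
ρ s t n (fsuc fzero) c with toℕ c ≟ n
... | yes _ = 1
... | no  _ = s (suc (toℕ c)) ∸ t (suc (toℕ c))

Total : {n : ℕ} → (Fin 2 → Fin (suc n) → ℕ) → ℕ
Total r = sum (tabulate λ i → sum (tabulate λ j → r i j))

Filling : (n N : ℕ) → Set
Filling n N = Vec (Vec (Subset N) (suc n)) 2

cell : {n N : ℕ} → Filling n N → Fin 2 → Fin (suc n) → Subset N
cell T r c = lookup (lookup T r) c

IsSVT : {n : ℕ} (ρ' : Fin 2 → Fin (suc n) → ℕ) → Filling n (Total ρ') → Set
IsSVT {n} ρ' T =
  (∀ r c → ∣ cell T r c ∣ ≡ ρ' r c) ×
  (∀ x → ∃ λ r → ∃ λ c → x ∈ˢ cell T r c) ×
  (∀ x r c r' c' → x ∈ˢ cell T r c → x ∈ˢ cell T r' c' → (r ≡ r' × c ≡ c')) ×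
  (∀ r (j : Fin n) x y → x ∈ˢ cell T r (inject₁ j) → y ∈ˢ cell T r (fsuc j) → x <ᶠ y) ×
  (∀ c x y → x ∈ˢ cell T fzero c → y ∈ˢ cell T (fsuc fzero) c → x <ᶠ y)

module Submission where

-- Write m = S s n for the number of balls and T i = t 1 + ... + t i.  The
-- proof goes through the ballot lawns: subsets L of the balls {1, …, m}
-- with |L| = T n and |L ∩ [1, S s i]| ≥ T i for every i ≤ n.
--  (1) Tennis: a set of balls is a possible lawn iff it is a ballot lawn.
--      The balls thrown in the first i turns are T i lawn balls ≤ S s i;
--      conversely, throwing the lawn balls in increasing order, t i of
--      them on turn i, is a valid run.
--  (2) Bijection: ballot lawns correspond to the tableaux.  Entries are
--      0, …, N - 1 with N = m + 2; the top row holds 0 and the lawn balls,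
--      the bottom row the other entries.  Rows increase, so the entries of
--      a row are distributed over its cells by rank (Blocks), hence a
--      tableau is determined by its top row; column strictness is exactly
--      the ballot inequality.
-- Ballot lawns form a decidable set of bit vectors, hence have some
-- cardinality k (Cardinality), which (1) and (2) transport to both sides.

open import Defs
open import Data.Nat using (ℕ; _≤_; _<_)
open import Data.Product using (∃; _×_; _,_; proj₁; proj₂)

module Cardinality where
  open import Data.Nat using (ℕ; zero; suc)
  open import Data.Bool using (Bool; true; false)
  open import Data.Vec using (Vec; []; _∷_)
  open import Data.Vec.Properties using (∷-injectiveʳ)
  open import Data.List using (List; []; _∷_; _++_; map; length; filter)
  open import Data.List.Properties using (length-map)
  open import Data.List.Membership.Propositional using (_∈_)
  open import Data.List.Membership.Propositional.Properties using (∈-filter⁺; ∈-filter⁻; ∈-map⁺; ∈-map⁻; ∈-++⁺ˡ; ∈-++⁺ʳ)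
  open import Data.List.Relation.Unary.Any using (here)
  open import Data.List.Relation.Unary.All using (All; []; _∷_)
  import Data.List.Relation.Unary.All as All
  open import Data.List.Relation.Unary.Unique.Propositional using (Unique; []; _∷_)
  import Data.List.Relation.Unary.Unique.Propositional.Properties as Unique
  open import Data.Product using (∃; _×_; _,_; proj₂)
  open import Relation.Binary.PropositionalEquality
  open import Relation.Nullary using (¬_)
  open import Function using (_∘_)
  open import Relation.Unary using (Decidable)
  open import Function.Bundles using (_⇔_; mk⇔; Equivalence)
  open Equivalence

  HasCard-⇔ : {A : Set} {P Q : A → Set} {k : ℕ} → (∀ x → P x ⇔ Q x) → HasCard P k → HasCard Q k
  HasCard-⇔ P⇔Q (xs , unique , members , length≡k) =
    xs , unique , (λ x → mk⇔ (to (P⇔Q x) ∘ to (members x)) (from (members x) ∘ from (P⇔Q x))) , length≡k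

  module _ {A B : Set} {P : A → Set} {Q : B → Set} (f : A → B) (g : B → A)
    (f-maps : ∀ x → P x → Q (f x)) (g-maps : ∀ y → Q y → P (g y))
    (g∘f : ∀ x → P x → g (f x) ≡ x) (f∘g : ∀ y → Q y → f (g y) ≡ y) where

    private
      f-injective : ∀ {x x'} → P x → P x' → f x ≡ f x' → x ≡ x'
      f-injective Px Px' fx≡fx' = trans (sym (g∘f _ Px)) (trans (cong g fx≡fx') (g∘f _ Px'))

      map-fresh : ∀ {x} xs → P x → All P xs → All (x ≢_) xs → All (f x ≢_) (map f xs)
      map-fresh []       _  _           _           = []
      map-fresh (x' ∷ xs) Px (Px' ∷ Pxs) (x≢x' ∷ fresh) =
        (x≢x' ∘ f-injective Px Px') ∷ map-fresh xs Px Pxs fresh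

      map-unique : ∀ xs → All P xs → Unique xs → Unique (map f xs)
      map-unique []       _          _              = []
      map-unique (x ∷ xs) (Px ∷ Pxs) (fresh ∷ uxs) = map-fresh xs Px Pxs fresh ∷ map-unique xs Pxs uxs

    HasCard-bij : ∀ {k} → HasCard P k → HasCard Q k
    HasCard-bij (xs , unique , members , length≡k) =
      map f xs , map-unique xs (All.tabulate (to (members _))) unique ,
      (λ y → mk⇔ (image y ∘ ∈-map⁻ f) (preimage y)) ,
      trans (length-map f xs) length≡k
      where
      image : ∀ y → ∃ (λ x → x ∈ xs × y ≡ f x) → Q y
      image y (x , x∈xs , refl) = f-maps x (to (members x) x∈xs)
      preimage : ∀ y → Q y → y ∈ map f xs
      preimage y Qy = subst (_∈ map f xs) (f∘g y Qy) (∈-map⁺ f (from (members (g y)) (g-maps y Qy)))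

  allVectors : (k : ℕ) → List (Vec Bool k)
  allVectors zero    = [] ∷ []
  allVectors (suc k) = map (true ∷_) (allVectors k) ++ map (false ∷_) (allVectors k)

  allVectors-complete : ∀ k (v : Vec Bool k) → v ∈ allVectors k
  allVectors-complete zero    []          = here refl
  allVectors-complete (suc k) (true ∷ v)  = ∈-++⁺ˡ (∈-map⁺ (true ∷_) (allVectors-complete k v))
  allVectors-complete (suc k) (false ∷ v) = ∈-++⁺ʳ (map (true ∷_) (allVectors k)) (∈-map⁺ (false ∷_) (allVectors-complete k v))

  allVectors-unique : ∀ k → Unique (allVectors k)
  allVectors-unique zero    = [] ∷ []
  allVectors-unique (suc k) =
    Unique.++⁺ (Unique.map⁺ ∷-injectiveʳ (allVectors-unique k)) (Unique.map⁺ ∷-injectiveʳ (allVectors-unique k)) heads-differ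
    where
    heads-differ : ∀ {v} → ¬ (v ∈ map (true ∷_) (allVectors k) × v ∈ map (false ∷_) (allVectors k))
    heads-differ (in-true , in-false) with ∈-map⁻ (true ∷_) in-true | ∈-map⁻ (false ∷_) in-false
    ... | _ , _ , refl | _ , _ , ()

  HasCard-decidable : ∀ {k} {P : Vec Bool k → Set} → Decidable P → ∃ λ c → HasCard P c
  HasCard-decidable {k} P? =
    length (filter P? (allVectors k)) ,
    filter P? (allVectors k) , Unique.filter⁺ P? (allVectors-unique k) ,
    (λ v → mk⇔ (proj₂ ∘ ∈-filter⁻ P? {xs = allVectors k}) (∈-filter⁺ P? (allVectors-complete k v))) , refl

module Counting where
  open import Data.Nat
  open import Data.Nat.Properties
  open import Data.Bool using (Bool; true; false; _∧_; _∨_)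
  open import Data.Product using (∃; _×_; _,_)
  open import Data.Fin using (toℕ)
  open import Data.Vec using (tabulate; sum)
  open import Data.Sum using (_⊎_; inj₁; inj₂)
  open import Data.Empty using (⊥; ⊥-elim)
  open import Relation.Binary.PropositionalEquality
  open import Function using (_∘_)
  open import Relation.Nullary using (Dec; yes; no; does)
  open import Relation.Nullary.Decidable using (dec-true; dec-false)
  open import Data.Bool.Properties using (∧-zeroʳ)
  open import Algebra.Properties.CommutativeSemigroup +-commutativeSemigroup using (interchange)

  does-true⁻ : {A : Set} (d : Dec A) → does d ≡ true → A
  does-true⁻ (yes a) _ = a

  true≢false : {b : Bool} → b ≡ true → b ≡ false → ⊥
  true≢false refl ()

  bool-split : (b : Bool) → b ≡ true ⊎ b ≡ false
  bool-split true  = inj₁ refl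
  bool-split false = inj₂ refl

  ∧-true⁻ : ∀ {a b} → (a ∧ b) ≡ true → a ≡ true × b ≡ true
  ∧-true⁻ {true} {true} _ = refl , refl

  ∧-true : ∀ {a b} → a ≡ true → b ≡ true → (a ∧ b) ≡ true
  ∧-true refl refl = refl

  ∨-true⁻ : ∀ {a b} → (a ∨ b) ≡ true → a ≡ true ⊎ b ≡ true
  ∨-true⁻ {true}  _ = inj₁ refl
  ∨-true⁻ {false} e = inj₂ e

  ∨-trueˡ : ∀ {a} b → a ≡ true → (a ∨ b) ≡ true
  ∨-trueˡ b refl = refl

  ∨-trueʳ : ∀ a {b} → b ≡ true → (a ∨ b) ≡ true
  ∨-trueʳ true  _ = refl
  ∨-trueʳ false e = e

  sumTo : (ℕ → ℕ) → ℕ → ℕ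
  sumTo g zero    = 0
  sumTo g (suc k) = sumTo g k + g k

  sumTo-ext : ∀ g h k → (∀ c → c < k → g c ≡ h c) → sumTo g k ≡ sumTo h k
  sumTo-ext g h zero    _ = refl
  sumTo-ext g h (suc k) e =
    cong₂ _+_ (sumTo-ext g h k (λ c c<k → e c (m<n⇒m<1+n c<k))) (e k ≤-refl)

  sumTo-shift : ∀ g k → sumTo g (suc k) ≡ g 0 + sumTo (λ c → g (suc c)) k
  sumTo-shift g zero    = +-comm 0 (g 0)
  sumTo-shift g (suc k) = trans (cong (_+ g (suc k)) (sumTo-shift g k)) (+-assoc (g 0) _ _)

  sumTo-mono : ∀ g {a b} → a ≤ b → sumTo g a ≤ sumTo g b
  sumTo-mono g a≤b = go (≤⇒≤′ a≤b)
    where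
    go : ∀ {a b} → a ≤′ b → sumTo g a ≤ sumTo g b
    go ≤′-refl       = ≤-refl
    go (≤′-step a≤b) = ≤-trans (go a≤b) (m≤m+n _ _)

  sumTo-stable : ∀ g {a b} → a ≤ b → (∀ c → a ≤ c → c < b → g c ≡ 0) → sumTo g b ≡ sumTo g a
  sumTo-stable g a≤b = go (≤⇒≤′ a≤b)
    where
    go : ∀ {a b} → a ≤′ b → (∀ c → a ≤ c → c < b → g c ≡ 0) → sumTo g b ≡ sumTo g a
    go ≤′-refl       _ = refl
    go {a} (≤′-step {b} a≤b) vanish =
      trans (cong (sumTo g b +_) (vanish b (≤′⇒≤ a≤b) ≤-refl))
            (trans (+-identityʳ _) (go a≤b (λ c a≤c c<b → vanish c a≤c (m<n⇒m<1+n c<b))))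

  sumTo-locate : ∀ g k q → q < sumTo g k → ∃ λ c → c < k × sumTo g c ≤ q × q < sumTo g (suc c)
  sumTo-locate g (suc k) q q<total with q <? sumTo g k
  ... | yes q<prev = let (c , c<k , lo , hi) = sumTo-locate g k q q<prev in c , m<n⇒m<1+n c<k , lo , hi
  ... | no q≮prev  = k , ≤-refl , ≮⇒≥ q≮prev , q<total

  sum-tabulate : ∀ k (h : ℕ → ℕ) → sum (tabulate {n = k} (λ j → h (toℕ j))) ≡ sumTo h k
  sum-tabulate zero    h = refl
  sum-tabulate (suc k) h = trans (cong (h 0 +_) (sum-tabulate k (λ c → h (suc c)))) (sym (sumTo-shift h k))

  indicator : Bool → ℕ
  indicator true  = 1
  indicator false = 0

  count : (ℕ → Bool) → ℕ → ℕ
  count f = sumTo (λ p → indicator (f p))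

  count-true : ∀ f p → f p ≡ true → count f (suc p) ≡ suc (count f p)
  count-true f p fp rewrite fp = +-comm (count f p) 1

  count-false : ∀ f p → f p ≡ false → count f (suc p) ≡ count f p
  count-false f p fp rewrite fp = +-identityʳ (count f p)

  count-shift : ∀ f k → count f (suc k) ≡ indicator (f 0) + count (λ p → f (suc p)) k
  count-shift f = sumTo-shift (λ p → indicator (f p))

  count-mono : ∀ f {a b} → a ≤ b → count f a ≤ count f b
  count-mono f = sumTo-mono (λ p → indicator (f p))

  count-< : ∀ f {p k} → f p ≡ true → p < k → count f p < count f k
  count-< f {p} {k} fp p<k = subst (_≤ count f k) (count-true f p fp) (count-mono f p<k)

  rank<⇒< : ∀ f {p P} → count f p < count f P → p < P
  rank<⇒< f {p} {P} rank< = ≰⇒> (λ P≤p → <⇒≱ rank< (count-mono f P≤p))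

  rank≥⇒≥ : ∀ f {q P} → f q ≡ true → count f P ≤ count f q → P ≤ q
  rank≥⇒≥ f {q} {P} fq rank≥ = ≮⇒≥ (λ q<P →
    <-irrefl refl (≤-trans (subst (_≤ count f P) (count-true f q fq) (count-mono f q<P)) rank≥))

  count-ext : ∀ f g k → (∀ p → p < k → f p ≡ g p) → count f k ≡ count g k
  count-ext f g k e = sumTo-ext _ _ k (λ p p<k → cong indicator (e p p<k))

  count-stable : ∀ f {a b} → a ≤ b → (∀ p → a ≤ p → p < b → f p ≡ false) → count f b ≡ count f a
  count-stable f a≤b none = sumTo-stable _ a≤b (λ p a≤p p<b → cong indicator (none p a≤p p<b))

  count-none : ∀ f k → (∀ p → p < k → f p ≡ false) → count f k ≡ 0
  count-none f k none = count-stable f z≤n (λ p _ → none p)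

  count-all : ∀ f k → (∀ p → p < k → f p ≡ true) → count f k ≡ k
  count-all f zero    _   = refl
  count-all f (suc k) all =
    trans (count-true f k (all k ≤-refl)) (cong suc (count-all f k (λ p p<k → all p (m<n⇒m<1+n p<k))))

  count-∨ : ∀ f g k → (∀ p → f p ≡ true → g p ≡ true → ⊥) →
    count (λ p → f p ∨ g p) k ≡ count f k + count g k
  count-∨ f g zero    _        = refl
  count-∨ f g (suc k) disjoint with f k in fk | g k in gk
  ... | true  | true  = ⊥-elim (disjoint k fk gk)
  ... | true  | false rewrite count-∨ f g k disjoint = interchange (count f k) (count g k) 1 0
  ... | false | true  rewrite count-∨ f g k disjoint = interchange (count f k) (count g k) 0 1
  ... | false | false rewrite count-∨ f g k disjoint = interchange (count f k) (count g k) 0 0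

  count-partition : ∀ f g k → (∀ p → f p ≡ true → g p ≡ true → ⊥) →
    (∀ p → p < k → (f p ∨ g p) ≡ true) → count f k + count g k ≡ k
  count-partition f g k disjoint cover =
    trans (sym (count-∨ f g k disjoint)) (count-all _ k cover)

  count-⊆ : ∀ f g k → (∀ p → f p ≡ true → g p ≡ true) → count f k ≤ count g k
  count-⊆ f g zero    _   = z≤n
  count-⊆ f g (suc k) f⊆g with f k in fk
  ... | true  rewrite f⊆g k fk = +-monoˡ-≤ 1 (count-⊆ f g k f⊆g)
  ... | false = +-mono-≤ (count-⊆ f g k f⊆g) z≤n

  count-single : ∀ y K → y < K → count (λ p → does (p ≟ y)) K ≡ 1
  count-single y K y<K = begin
    count (_≐ y) K        ≡⟨ count-stable (_≐ y) y<K (λ p y<p _ → dec-false (p ≟ y) (>⇒≢ y<p)) ⟩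
    count (_≐ y) (suc y)  ≡⟨ count-true (_≐ y) y (dec-true (y ≟ y) refl) ⟩
    suc (count (_≐ y) y)  ≡⟨ cong suc (count-none (_≐ y) y (λ p p<y → dec-false (p ≟ y) (<⇒≢ p<y))) ⟩
    1                     ∎
    where
    open ≡-Reasoning
    _≐_ : ℕ → ℕ → Bool
    p ≐ y = does (p ≟ y)

  count-rank : ∀ f P k → k < count f P → ∃ λ y → y < P × f y ≡ true × count f y ≡ k
  count-rank f (suc P) k k<total with k <? count f P
  ... | yes k<prev = let (y , y<P , fy , rank) = count-rank f P k k<prev in y , m<n⇒m<1+n y<P , fy , rank
  ... | no k≮prev with f P in fP
  ...   | true  = P , ≤-refl , fP , ≤-antisym (≮⇒≥ k≮prev) (≤-pred (subst (k <_) (+-comm (count f P) 1) k<total))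
  ...   | false = ⊥-elim (k≮prev (subst (k <_) (+-identityʳ _) k<total))

  window : (ℕ → Bool) → ℕ → ℕ → ℕ → Bool
  window f A B p = f p ∧ (does (A ≤? count f p) ∧ does (count f p <? B))

  window-ext : ∀ f g A B p → (∀ q → f q ≡ g q) → window f A B p ≡ window g A B p
  window-ext f g A B p same =
    cong₂ (λ b k → b ∧ (does (A ≤? k) ∧ does (k <? B))) (same p) (count-ext f g p (λ q _ → same q))


  window⁻ : ∀ f A B p → window f A B p ≡ true → f p ≡ true × A ≤ count f p × count f p < B
  window⁻ f A B p w with ∧-true⁻ {f p} w
  ... | fp , ranks with ∧-true⁻ {does (A ≤? count f p)} ranks
  ...   | A≤ , <B = fp , does-true⁻ (A ≤? _) A≤ , does-true⁻ (_ <? B) <B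

  window⁺ : ∀ f A B p → f p ≡ true → A ≤ count f p → count f p < B → window f A B p ≡ true
  window⁺ f A B p fp A≤ <B = ∧-true fp (∧-true (dec-true (A ≤? _) A≤) (dec-true (_ <? B) <B))

  -- A window of ranks [A, B) contains min(|f|, B) - A elements.  A new
  -- member of rank r = count f N changes both sides exactly when A ≤ r < B.
  count-window : ∀ f A B N → count (window f A B) N ≡ (count f N ⊓ B) ∸ A
  count-window f A B zero = sym (0∸n≡0 A)
  count-window f A B (suc N) with f N in fN
  ... | false rewrite +-identityʳ (count f N) | +-identityʳ (count (window f A B) N) = count-window f A B N
  ... | true rewrite count-window f A B N | +-comm (count f N) 1 with suc (count f N) ≤? B
  ...   | no r≮B rewrite dec-false (count f N <? B) r≮B | ∧-zeroʳ (does (A ≤? count f N)) =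
    trans (+-identityʳ _)
          (cong (_∸ A) (trans (m≥n⇒m⊓n≡n (≤-pred (≰⇒> r≮B))) (sym (m≥n⇒m⊓n≡n (<⇒≤ (≰⇒> r≮B))))))
  ...   | yes r<B rewrite dec-true (count f N <? B) r<B | m≤n⇒m⊓n≡m r<B | m≤n⇒m⊓n≡m (<⇒≤ r<B)
    with A ≤? count f N
  ...     | yes A≤r rewrite dec-true (A ≤? count f N) A≤r =
    sym (trans (cong (_∸ A) (+-comm 1 (count f N))) (+-∸-comm 1 A≤r))
  ...     | no A≰r rewrite dec-false (A ≤? count f N) A≰r =
    trans (+-identityʳ _) (trans (m≤n⇒m∸n≡0 (<⇒≤ (≰⇒> A≰r))) (sym (m≤n⇒m∸n≡0 (≰⇒> A≰r))))

  anyBelow : (ℕ → ℕ → Bool) → ℕ → ℕ → Bool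
  anyBelow D zero    p = false
  anyBelow D (suc k) p = anyBelow D k p ∨ D k p

  anyBelow-ext : ∀ D D' k p → (∀ c → c < k → D c p ≡ D' c p) → anyBelow D k p ≡ anyBelow D' k p
  anyBelow-ext D D' zero    p _    = refl
  anyBelow-ext D D' (suc k) p same =
    cong₂ _∨_ (anyBelow-ext D D' k p (λ c c<k → same c (m<n⇒m<1+n c<k))) (same k ≤-refl)

  anyBelow⁺ : ∀ D k c p → c < k → D c p ≡ true → anyBelow D k p ≡ true
  anyBelow⁺ D (suc k) c p c<1+k Dcp with c ≟ k
  ... | yes refl = ∨-trueʳ (anyBelow D c p) Dcp
  ... | no c≢k   = ∨-trueˡ (D k p) (anyBelow⁺ D k c p (≤-pred (≤∧≢⇒< c<1+k (c≢k ∘ suc-injective))) Dcp)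

  anyBelow⁻ : ∀ D k p → anyBelow D k p ≡ true → ∃ λ c → c < k × D c p ≡ true
  anyBelow⁻ D (suc k) p any with ∨-true⁻ {anyBelow D k p} any
  ... | inj₁ earlier = let (c , c<k , Dcp) = anyBelow⁻ D k p earlier in c , m<n⇒m<1+n c<k , Dcp
  ... | inj₂ last    = k , ≤-refl , last

  count-anyBelow : ∀ D k N → (∀ c c' p → c < k → c' < k → D c p ≡ true → D c' p ≡ true → c ≡ c') →
    count (anyBelow D k) N ≡ sumTo (λ c → count (D c) N) k
  count-anyBelow D zero    N _        = count-none _ N (λ _ _ → refl)
  count-anyBelow D (suc k) N disjoint =
    trans (count-∨ (anyBelow D k) (D k) N new)
          (cong (_+ count (D k) N) (count-anyBelow D k N (λ c c' p c<k c'<k → disjoint c c' p (m<n⇒m<1+n c<k) (m<n⇒m<1+n c'<k))))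
    where
    new : ∀ p → anyBelow D k p ≡ true → D k p ≡ true → ⊥
    new p earlier Dkp with anyBelow⁻ D k p earlier
    ... | c , c<k , Dcp = <-irrefl (disjoint c k p (m<n⇒m<1+n c<k) ≤-refl Dcp Dkp) c<k

module Enumeration where
  open Counting
  open import Data.Nat
  open import Data.Nat.Properties
  open import Data.Bool using (Bool; true; false; _∨_)
  import Data.Bool.Properties as Bool
  open import Data.List using (List; []; _∷_; length; filter; downFrom)
  open import Data.List.Membership.Propositional using (_∈_)
  open import Data.List.Membership.DecPropositional _≟_ using (_∈?_)
  open import Data.List.Membership.Propositional.Properties using (∈-filter⁺; ∈-filter⁻; ∈-downFrom⁺; ∈-downFrom⁻)
  open import Data.List.Relation.Unary.All using (All; []; _∷_)
  import Data.List.Relation.Unary.All as All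
  open import Data.List.Relation.Unary.Unique.Propositional using (Unique; []; _∷_)
  import Data.List.Relation.Unary.Unique.Propositional.Properties as Unique
  open import Data.Product using (_×_; _,_)
  open import Data.Empty using (⊥)
  open import Relation.Binary.PropositionalEquality
  open import Relation.Nullary using (does)

  count-∈ : ∀ K (xs : List ℕ) → Unique xs → All (_< K) xs → count (λ b → does (b ∈? xs)) K ≡ length xs
  count-∈ K []       _          _            = count-none _ K (λ _ _ → refl)
  count-∈ K (x ∷ xs) (x∉ ∷ uxs) (x<K ∷ xs<K) = begin
    count (λ b → does (b ≟ x) ∨ does (b ∈? xs)) K                  ≡⟨ count-∨ _ _ K fresh ⟩
    count (λ b → does (b ≟ x)) K + count (λ b → does (b ∈? xs)) K  ≡⟨ cong₂ _+_ (count-single x K x<K)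
                                                                                  (count-∈ K xs uxs xs<K) ⟩
    suc (length xs)                                                ∎
    where
    open ≡-Reasoning
    fresh : ∀ b → does (b ≟ x) ≡ true → does (b ∈? xs) ≡ true → ⊥
    fresh b b≡x b∈xs with does-true⁻ (b ≟ x) b≡x | does-true⁻ (b ∈? xs) b∈xs
    ... | refl | x∈xs = All.lookup x∉ x∈xs refl

  members : (ℕ → Bool) → ℕ → List ℕ
  members f K = filter (λ b → f b Bool.≟ true) (downFrom K)

  members-unique : ∀ f K → Unique (members f K)
  members-unique f K = Unique.filter⁺ (λ b → f b Bool.≟ true) (Unique.downFrom⁺ K)

  members⁻ : ∀ f K {b} → b ∈ members f K → b < K × f b ≡ true
  members⁻ f K b∈ with ∈-filter⁻ (λ b → f b Bool.≟ true) {xs = downFrom K} b∈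
  ... | b∈K , fb = ∈-downFrom⁻ b∈K , fb

  members⁺ : ∀ f K {b} → b < K → f b ≡ true → b ∈ members f K
  members⁺ f K b<K fb = ∈-filter⁺ (λ b → f b Bool.≟ true) (∈-downFrom⁺ b<K) fb

  length-members : ∀ f K → length (members f K) ≡ count f K
  length-members f zero    = refl
  length-members f (suc K) with f K
  ... | true  = trans (cong suc (length-members f K)) (+-comm 1 (count f K))
  ... | false = trans (length-members f K) (sym (+-identityʳ (count f K)))

module Bits where
  open Counting
  open import Data.Nat
  open import Data.Nat.Properties
  open import Data.Bool using (Bool; true; false)
  open import Data.Fin using (Fin; toℕ; fromℕ<) renaming (zero to fzero; suc to fsuc)
  open import Data.Fin.Properties using (toℕ-fromℕ<)
  open import Data.Fin.Subset using (Subset; ∣_∣) renaming (_∈_ to _∈ˢ_)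
  open import Data.Vec using (Vec; []; _∷_; lookup; tabulate)
  open import Data.Vec.Properties using (lookup∘tabulate; []=⇒lookup; lookup⇒[]=)
  open import Data.Product using (_×_; _,_)
  open import Data.Empty using (⊥-elim)
  open import Relation.Binary.PropositionalEquality
  open import Relation.Nullary using (yes; no)
  open import Function.Bundles using (_⇔_; mk⇔)

  bit : ∀ {k} → Vec Bool k → ℕ → Bool
  bit []      p       = false
  bit (b ∷ v) zero    = b
  bit (b ∷ v) (suc p) = bit v p

  bit-lookup : ∀ {k} (v : Vec Bool k) (x : Fin k) → bit v (toℕ x) ≡ lookup v x
  bit-lookup (b ∷ v) fzero    = refl
  bit-lookup (b ∷ v) (fsuc x) = bit-lookup v x

  bit-beyond : ∀ {k} (v : Vec Bool k) p → k ≤ p → bit v p ≡ false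
  bit-beyond []      p       _         = refl
  bit-beyond (b ∷ v) (suc p) (s≤s k≤p) = bit-beyond v p k≤p

  bit-bound : ∀ {k} (v : Vec Bool k) p → bit v p ≡ true → p < k
  bit-bound {k} v p vp with p <? k
  ... | yes p<k = p<k
  ... | no p≮k  = ⊥-elim (true≢false vp (bit-beyond v p (≮⇒≥ p≮k)))

  ∈⇔bit : ∀ {k} (v : Subset k) (x : Fin k) → (x ∈ˢ v) ⇔ (bit v (toℕ x) ≡ true)
  ∈⇔bit v x = mk⇔ (λ x∈v → trans (bit-lookup v x) ([]=⇒lookup x∈v))
                  (λ vx → lookup⇒[]= x v (trans (sym (bit-lookup v x)) vx))

  ∣∣≡count : ∀ {k} (v : Subset k) → ∣ v ∣ ≡ count (bit v) k
  ∣∣≡count [] = refl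
  ∣∣≡count {suc k} (true ∷ v)  = sym (trans (count-shift (bit (true ∷ v)) k) (cong suc (sym (∣∣≡count v))))
  ∣∣≡count {suc k} (false ∷ v) = sym (trans (count-shift (bit (false ∷ v)) k) (sym (∣∣≡count v)))

  bit-tabulate : ∀ {k} (h : ℕ → Bool) p → p < k → bit (tabulate {n = k} (λ x → h (toℕ x))) p ≡ h p
  bit-tabulate {k} h p p<k = begin
    bit v p                    ≡⟨ cong (bit v) (sym (toℕ-fromℕ< p<k)) ⟩
    bit v (toℕ (fromℕ< p<k))   ≡⟨ bit-lookup v (fromℕ< p<k) ⟩
    lookup v (fromℕ< p<k)      ≡⟨ lookup∘tabulate _ (fromℕ< p<k) ⟩
    h (toℕ (fromℕ< p<k))       ≡⟨ cong h (toℕ-fromℕ< p<k) ⟩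
    h p                        ∎
    where
    open ≡-Reasoning
    v = tabulate {n = k} (λ x → h (toℕ x))

  ∣tabulate∣ : ∀ {k} (h : ℕ → Bool) → ∣ tabulate {n = k} (λ x → h (toℕ x)) ∣ ≡ count h k
  ∣tabulate∣ {k} h = trans (∣∣≡count (tabulate {n = k} (λ x → h (toℕ x)))) (count-ext _ _ k (bit-tabulate {k} h))

  bits : ∀ {k N} → Vec (Vec Bool N) k → ℕ → ℕ → Bool
  bits []       c       p = false
  bits (v ∷ vs) zero    p = bit v p
  bits (v ∷ vs) (suc c) p = bits vs c p

  bits-lookup : ∀ {k N} (vs : Vec (Vec Bool N) k) (c : Fin k) p → bits vs (toℕ c) p ≡ bit (lookup vs c) p
  bits-lookup (v ∷ vs) fzero    p = refl
  bits-lookup (v ∷ vs) (fsuc c) p = bits-lookup vs c p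

  bits-bound : ∀ {k N} (vs : Vec (Vec Bool N) k) c p → bits vs c p ≡ true → c < k × p < N
  bits-bound (v ∷ vs) zero    p vp = s≤s z≤n , bit-bound v p vp
  bits-bound (v ∷ vs) (suc c) p vp with bits-bound vs c p vp
  ... | c<k , p<N = s≤s c<k , p<N

-- A row of n+1 cells with density ρ' (cell c receives ρ' c entries) and a
-- set R of entries for the whole row.  Since rows increase, the only way
-- to distribute R is by rank: cell c gets the members of rank in
-- [B c, B (c+1)), B being the partial sums of ρ'.
module Blocks where
  open Counting
  open import Data.Nat
  open import Data.Nat.Properties
  open import Data.Bool using (Bool; true; false)
  open import Data.Product using (∃; _×_; _,_; proj₁)
  open import Data.Sum using (inj₁; inj₂)
  open import Data.Empty using (⊥-elim)
  open import Relation.Binary using (tri<; tri≈; tri>)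
  open import Relation.Binary.PropositionalEquality

  module Row (n : ℕ) (ρ' : ℕ → ℕ) where

    B : ℕ → ℕ
    B = sumTo ρ'

    block : (ℕ → Bool) → ℕ → ℕ → Bool
    block R c = window R (B c) (B (suc c))

    block⁻ : ∀ R c p → block R c p ≡ true → R p ≡ true × B c ≤ count R p × count R p < B (suc c)
    block⁻ R c = window⁻ R (B c) (B (suc c))

    block⁺ : ∀ R c p → R p ≡ true → B c ≤ count R p → count R p < B (suc c) → block R c p ≡ true
    block⁺ R c = window⁺ R (B c) (B (suc c))

    block-ext : ∀ R R' c p → (∀ q → R q ≡ R' q) → block R c p ≡ block R' c p
    block-ext R R' c = window-ext R R' (B c) (B (suc c))

    B-step : ∀ {c c'} → c < c' → B (suc c) ≤ B c'
    B-step c<c' = sumTo-mono ρ' c<c'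

    block-unique : ∀ R c c' p → block R c p ≡ true → block R c' p ≡ true → c ≡ c'
    block-unique R c c' p in-c in-c' with block⁻ R c p in-c | block⁻ R c' p in-c' | <-cmp c c'
    ... | _ , lo , hi | _ , lo' , hi' | tri< c<c' _ _ = ⊥-elim (<⇒≱ hi (≤-trans (B-step c<c') lo'))
    ... | _ , _  , _  | _ , _   , _   | tri≈ _ c≡c' _ = c≡c'
    ... | _ , lo , hi | _ , lo' , hi' | tri> _ _ c'<c = ⊥-elim (<⇒≱ hi' (≤-trans (B-step c'<c) lo))

    block-exists : ∀ R p → R p ≡ true → count R p < B (suc n) → ∃ λ c → c ≤ n × block R c p ≡ true
    block-exists R p Rp rank< with sumTo-locate ρ' (suc n) (count R p) rank<
    ... | c , c<1+n , lo , hi = c , ≤-pred c<1+n , block⁺ R c p Rp lo hi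

    block-increasing : ∀ R c p q → block R c p ≡ true → block R (suc c) q ≡ true → p < q
    block-increasing R c p q in-c in-next with block⁻ R c p in-c | block⁻ R (suc c) q in-next
    ... | _ , _ , hi | _ , lo , _ = ≰⇒> (λ q≤p → <⇒≱ hi (≤-trans lo (count-mono R q≤p)))

    block-size : ∀ R N → count R N ≡ B (suc n) → ∀ c → c ≤ n → count (block R c) N ≡ ρ' c
    block-size R N total c c≤n = begin
      count (block R c) N                ≡⟨ count-window R (B c) (B (suc c)) N ⟩
      (count R N ⊓ B (suc c)) ∸ B c      ≡⟨ cong (λ k → (k ⊓ B (suc c)) ∸ B c) total ⟩
      (B (suc n) ⊓ B (suc c)) ∸ B c      ≡⟨ cong (_∸ B c) (m≥n⇒m⊓n≡n (sumTo-mono ρ' (s≤s c≤n))) ⟩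
      B (suc c) ∸ B c                    ≡⟨ m+n∸m≡n (B c) (ρ' c) ⟩
      ρ' c                               ∎
      where open ≡-Reasoning

    blocks-cover : ∀ R N → count R N ≡ B (suc n) → (∀ p → R p ≡ true → p < N) →
      ∀ p → anyBelow (block R) (suc n) p ≡ R p
    blocks-cover R N total bounded p with bool-split (R p)
    ... | inj₁ Rp with block-exists R p Rp (subst (count R p <_) total (count-< R Rp (bounded p Rp)))
    ...   | c , c≤n , in-c = trans (anyBelow⁺ (block R) (suc n) c p (s≤s c≤n) in-c) (sym Rp)
    blocks-cover R N total bounded p | inj₂ ¬Rp with bool-split (anyBelow (block R) (suc n) p)
    ... | inj₂ none = trans none (sym ¬Rp)
    ... | inj₁ some with anyBelow⁻ (block R) (suc n) p some
    ...   | c , _ , in-c = ⊥-elim (true≢false (proj₁ (block⁻ R c p in-c)) ¬Rp)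

    -- Conversely, any increasing filling of the row with nonempty cells
    -- of the prescribed sizes is the distribution by rank of its entries.
    module Rigidity (D : ℕ → ℕ → Bool) (N : ℕ)
      (nonempty : ∀ c → c ≤ n → 1 ≤ ρ' c)
      (size : ∀ c → c ≤ n → count (D c) N ≡ ρ' c)
      (bound : ∀ c p → D c p ≡ true → p < N)
      (disjoint : ∀ c c' p → D c p ≡ true → D c' p ≡ true → c ≡ c')
      (increasing : ∀ c p q → c < n → D c p ≡ true → D (suc c) q ≡ true → p < q) where

      entries : ℕ → Bool
      entries = anyBelow D (suc n)

      some-entry : ∀ c → c ≤ n → ∃ λ z → D c z ≡ true
      some-entry c c≤n with count-rank (D c) N 0 (subst (0 <_) (sym (size c c≤n)) (nonempty c c≤n))
      ... | z , _ , Dz , _ = z , Dz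

      increasing* : ∀ c c' q p → c < c' → c' ≤ n → D c q ≡ true → D c' p ≡ true → q < p
      increasing* c (suc c') q p c<1+c' 1+c'≤n Dq Dp with m<1+n⇒m<n∨m≡n c<1+c'
      ... | inj₂ refl = increasing c q p 1+c'≤n Dq Dp
      ... | inj₁ c<c' with some-entry c' (<⇒≤ 1+c'≤n)
      ...   | z , Dz = <-trans (increasing* c c' q z c<c' (<⇒≤ 1+c'≤n) Dq Dz) (increasing c' z p 1+c'≤n Dz Dp)

      disjoint< : ∀ c c' p → c < suc n → c' < suc n → D c p ≡ true → D c' p ≡ true → c ≡ c'
      disjoint< c c' p _ _ = disjoint c c' p

      total : count entries N ≡ B (suc n)
      total = trans (count-anyBelow D (suc n) N disjoint<)
                    (sumTo-ext _ _ (suc n) (λ c c<1+n → size c (≤-pred c<1+n)))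

      rank : ∀ c p → c ≤ n → D c p ≡ true → count entries p ≡ B c + count (D c) p
      rank c p c≤n Dp = begin
        count entries p                               ≡⟨ count-anyBelow D (suc n) p disjoint< ⟩
        sumTo before (suc n)                          ≡⟨ sumTo-stable before (s≤s c≤n) later-empty ⟩
        sumTo before c + count (D c) p                ≡⟨ cong (_+ count (D c) p) (sumTo-ext before ρ' c earlier-full) ⟩
        B c + count (D c) p                           ∎
        where
        open ≡-Reasoning
        before : ℕ → ℕ
        before c' = count (D c') p
        earlier-full : ∀ c' → c' < c → before c' ≡ ρ' c'
        earlier-full c' c'<c =
          trans (sym (count-stable (D c') (<⇒≤ (bound c p Dp)) none-after)) (size c' (≤-trans (<⇒≤ c'<c) c≤n))
          where
          none-after : ∀ q → p ≤ q → q < N → D c' q ≡ false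
          none-after q p≤q _ with bool-split (D c' q)
          ... | inj₂ absent = absent
          ... | inj₁ Dq = ⊥-elim (<⇒≱ (increasing* c' c q p c'<c c≤n Dq Dp) p≤q)
        later-empty : ∀ c' → suc c ≤ c' → c' < suc n → before c' ≡ 0
        later-empty c' c<c' c'<1+n = count-none (D c') p none-before
          where
          none-before : ∀ q → q < p → D c' q ≡ false
          none-before q q<p with bool-split (D c' q)
          ... | inj₂ absent = absent
          ... | inj₁ Dq = ⊥-elim (<⇒≱ (increasing* c c' p q c<c' (≤-pred c'<1+n) Dp Dq) (<⇒≤ q<p))

      cell⇒block : ∀ c p → c ≤ n → D c p ≡ true → block entries c p ≡ true
      cell⇒block c p c≤n Dp = block⁺ entries c p (anyBelow⁺ D (suc n) c p (s≤s c≤n) Dp)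
        (subst (B c ≤_) (sym (rank c p c≤n Dp)) (m≤m+n _ _))
        (subst (_< B (suc c)) (sym (rank c p c≤n Dp))
          (+-monoʳ-< (B c) (subst (count (D c) p <_) (size c c≤n) (count-< (D c) Dp (bound c p Dp)))))

      cell≡block : ∀ c p → c ≤ n → D c p ≡ block entries c p
      cell≡block c p c≤n with bool-split (D c p) | bool-split (block entries c p)
      ... | inj₁ Dp | _ = trans Dp (sym (cell⇒block c p c≤n Dp))
      ... | inj₂ ¬Dp | inj₂ ¬block = trans ¬Dp (sym ¬block)
      ... | inj₂ ¬Dp | inj₁ in-block with block⁻ entries c p in-block
      ...   | is-entry , _ with anyBelow⁻ D (suc n) p is-entry
      ...     | c' , c'<1+n , Dc'p with block-unique entries c' c p (cell⇒block c' p (≤-pred c'<1+n) Dc'p) in-block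
      ...       | refl = ⊥-elim (true≢false Dc'p ¬Dp)

module Tennis where
  open Counting
  open Enumeration
  open Bits
  open import Data.Nat
  open import Data.Nat.Properties
  open import Data.Bool using (Bool; true; false)
  open import Data.Fin using (Fin; toℕ; fromℕ<)
  open import Data.Fin.Properties using (toℕ<n; toℕ-fromℕ<)
  open import Data.Fin.Subset using (Subset) renaming (_∈_ to _∈ˢ_)
  open import Data.List using (List; []; length)
  open import Data.List.Membership.Propositional using (_∈_)
  open import Data.List.Membership.DecPropositional _≟_ using (_∈?_)
  open import Data.List.Relation.Unary.All using (All)
  import Data.List.Relation.Unary.All as All
  open import Data.Product using (∃; _×_; _,_; proj₁; proj₂)
  open import Data.Empty using (⊥-elim)
  open import Relation.Binary using (tri<; tri≈; tri>)
  open import Relation.Binary.PropositionalEquality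
  open import Relation.Nullary using (Dec; yes; no; does; ¬_)
  open import Relation.Nullary.Decidable using (dec-true; map′; _×-dec_)
  open import Function.Bundles using (_⇔_; mk⇔; Equivalence)
  open Equivalence

  S≡sumTo : ∀ f k → S f k ≡ sumTo (λ c → f (suc c)) k
  S≡sumTo f zero    = refl
  S≡sumTo f (suc k) = cong (_+ f (suc k)) (S≡sumTo f k)

  S-mono : ∀ f {a b} → a ≤ b → S f a ≤ S f b
  S-mono f {a} {b} a≤b = subst₂ _≤_ (sym (S≡sumTo f a)) (sym (S≡sumTo f b)) (sumTo-mono _ a≤b)

  S-locate : ∀ f k q → q < S f k → ∃ λ j → j < k × S f j ≤ q × q < S f (suc j)
  S-locate f k q q<total with sumTo-locate (λ c → f (suc c)) k q (subst (q <_) (S≡sumTo f k) q<total)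
  ... | j , j<k , lo , hi = j , j<k , subst (_≤ q) (sym (S≡sumTo f j)) lo , subst (q <_) (sym (S≡sumTo f (suc j))) hi

  -- The possible lawns are characterised by a ballot condition: a set L of
  -- balls is on the lawn after n turns iff |L| = t 1 + ... + t n and, for
  -- every i ≤ n, at least t 1 + ... + t i balls of L are ≤ S s i (those
  -- thrown during the first i turns must be among the first S s i balls).

  module Ballot (s t : ℕ → ℕ) (n : ℕ) where

    m : ℕ
    m = S s n

    ball : Subset m → ℕ → Bool
    ball L zero    = false
    ball L (suc x) = bit L x

    count-ball : ∀ L k → count (ball L) (suc k) ≡ count (bit L) k
    count-ball L = count-shift (ball L)

    IsBallot : Subset m → Set
    IsBallot L = (count (bit L) m ≡ S t n) × (∀ i → i ≤ n → S t i ≤ count (bit L) (S s i))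

    isBallot? : ∀ L → Dec (IsBallot L)
    isBallot? L = (count (bit L) m ≟ S t n) ×-dec
      map′ (λ prefix i i≤n → prefix {i} (s≤s i≤n)) (λ prefix {i} i<1+n → prefix i (≤-pred i<1+n))
           (allUpTo? (λ i → S t i ≤? count (bit L) (S s i)) (suc n))

    ball⁺ : ∀ L (x : Fin m) → x ∈ˢ L → ball L (suc (toℕ x)) ≡ true
    ball⁺ L x = to (∈⇔bit L x)

    ball⁻ : ∀ L b → ball L b ≡ true → ∃ λ (x : Fin m) → suc (toℕ x) ≡ b × x ∈ˢ L
    ball⁻ L (suc x) Lx = x' , cong suc (toℕ-fromℕ< x<m) ,
      from (∈⇔bit L x') (subst (λ y → bit L y ≡ true) (sym (toℕ-fromℕ< x<m)) Lx)
      where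
      x<m = bit-bound L x Lx
      x' = fromℕ< x<m

    -- A run produces a lawn satisfying the ballot condition: the balls
    -- thrown during the first i turns are t 1 + ... + t i lawn balls ≤ S s i.
    module FromRun (L : Subset m) (Th : ℕ → List ℕ) (run : ValidRun s t n Th)
      (lawn : ∀ (x : Fin m) → (x ∈ˢ L) ⇔ (∃ λ i → 1 ≤ i × i ≤ n × suc (toℕ x) ∈ Th i)) where

      thrownOn : ℕ → ℕ → Bool
      thrownOn c b = does (b ∈? Th (suc c))

      thrownBy : ℕ → ℕ → Bool
      thrownBy = anyBelow thrownOn

      thrown-range : ∀ c → c < n → ∀ b → b ∈ Th (suc c) → 1 ≤ b × b ≤ S s (suc c)
      thrown-range c c<n b b∈ = proj₁ (proj₂ (proj₂ (run (suc c) (s≤s z≤n) c<n)) b b∈)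

      thrown-fresh : ∀ c → c < n → ∀ b → b ∈ Th (suc c) → ∀ j → 1 ≤ j → j < suc c → ¬ (b ∈ Th j)
      thrown-fresh c c<n b b∈ = proj₂ (proj₂ (proj₂ (run (suc c) (s≤s z≤n) c<n)) b b∈)

      thrown-once : ∀ k → k ≤ n → ∀ c c' b → c < k → c' < k → thrownOn c b ≡ true → thrownOn c' b ≡ true → c ≡ c'
      thrown-once k k≤n c c' b c<k c'<k on-c on-c' with <-cmp c c'
      ... | tri< c<c' _ _ = ⊥-elim (thrown-fresh c' (≤-trans c'<k k≤n) b (does-true⁻ (b ∈? _) on-c')
                                     (suc c) (s≤s z≤n) (s≤s c<c') (does-true⁻ (b ∈? _) on-c))
      ... | tri≈ _ c≡c' _ = c≡c'
      ... | tri> _ _ c'<c = ⊥-elim (thrown-fresh c (≤-trans c<k k≤n) b (does-true⁻ (b ∈? _) on-c)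
                                     (suc c') (s≤s z≤n) (s≤s c'<c) (does-true⁻ (b ∈? _) on-c'))

      count-thrownBy : ∀ k → k ≤ n → count (thrownBy k) (suc (S s k)) ≡ S t k
      count-thrownBy k k≤n = begin
        count (thrownBy k) K                   ≡⟨ count-anyBelow thrownOn k K (thrown-once k k≤n) ⟩
        sumTo (λ c → count (thrownOn c) K) k   ≡⟨ sumTo-ext _ _ k per-turn ⟩
        sumTo (λ c → t (suc c)) k              ≡⟨ sym (S≡sumTo t k) ⟩
        S t k                                  ∎
        where
        open ≡-Reasoning
        K = suc (S s k)
        per-turn : ∀ c → c < k → count (thrownOn c) K ≡ t (suc c)
        per-turn c c<k with run (suc c) (s≤s z≤n) (≤-trans c<k k≤n)
        ... | unique , length≡t , _ = trans (count-∈ K (Th (suc c)) unique early) length≡t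
          where
          early : All (_< K) (Th (suc c))
          early = All.tabulate (λ {b} b∈ → s≤s (≤-trans (proj₂ (thrown-range c (≤-trans c<k k≤n) b b∈)) (S-mono s c<k)))

      thrown⇒lawn : ∀ k → k ≤ n → ∀ b → thrownBy k b ≡ true → ball L b ≡ true
      thrown⇒lawn k k≤n b thrown with anyBelow⁻ thrownOn k b thrown
      ... | c , c<k , on-c with does-true⁻ (b ∈? _) on-c
      ...   | b∈ with thrown-range c (≤-trans c<k k≤n) b b∈
      ...     | s≤s _ , b≤ = ball-of (fromℕ< x<m) (toℕ-fromℕ< x<m)
        where
        x<m : b ∸ 1 < m
        x<m = ≤-trans b≤ (S-mono s (≤-trans c<k k≤n))
        ball-of : ∀ (x : Fin m) → toℕ x ≡ b ∸ 1 → ball L b ≡ true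
        ball-of x refl = ball⁺ L x (from (lawn x) (suc c , s≤s z≤n , ≤-trans c<k k≤n , b∈))

      lawn⇒thrown : ∀ b → ball L b ≡ true → thrownBy n b ≡ true
      lawn⇒thrown b Lb with ball⁻ L b Lb
      ... | x , refl , x∈L with to (lawn x) x∈L
      ...   | suc c , _ , c<n , b∈ = anyBelow⁺ thrownOn n c b c<n (dec-true (b ∈? Th (suc c)) b∈)

      prefix : ∀ i → i ≤ n → S t i ≤ count (bit L) (S s i)
      prefix i i≤n = subst₂ _≤_ (count-thrownBy i i≤n) (count-ball L (S s i))
        (count-⊆ (thrownBy i) (ball L) (suc (S s i)) (thrown⇒lawn i i≤n))

      isBallot : IsBallot L
      isBallot = ≤-antisym total≤ (prefix n ≤-refl) , prefix
        where
        total≤ : count (bit L) m ≤ S t n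
        total≤ = subst₂ _≤_ (count-ball L m) (count-thrownBy n ≤-refl)
          (count-⊆ (ball L) (thrownBy n) (suc m) lawn⇒thrown)

    -- Conversely, a ballot lawn is produced by the run which throws, on
    -- turn j + 1, the lawn balls of rank in [S t j, S t (j + 1)).
    module ToRun (L : Subset m) (ballot : IsBallot L) where

      turnOf : ℕ → ℕ → Bool
      turnOf j = window (ball L) (S t j) (S t (suc j))

      Th : ℕ → List ℕ
      Th zero    = []
      Th (suc j) = members (turnOf j) (suc m)

      total : count (ball L) (suc m) ≡ S t n
      total = trans (count-ball L m) (proj₁ ballot)

      thrown⁻ : ∀ j b → b ∈ Th (suc j) →
        b < suc m × ball L b ≡ true × S t j ≤ count (ball L) b × count (ball L) b < S t (suc j)
      thrown⁻ j b b∈ with members⁻ (turnOf j) (suc m) b∈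
      ... | b<1+m , in-turn = b<1+m , window⁻ (ball L) (S t j) (S t (suc j)) b in-turn

      -- Turn j + 1 throws t (j + 1) balls, since the lawn has S t n ≥ S t (j + 1).
      length-turn : ∀ j → suc j ≤ n → length (Th (suc j)) ≡ t (suc j)
      length-turn j j<n = begin
        length (Th (suc j))                                  ≡⟨ length-members (turnOf j) (suc m) ⟩
        count (turnOf j) (suc m)                             ≡⟨ count-window (ball L) (S t j) (S t (suc j)) (suc m) ⟩
        (count (ball L) (suc m) ⊓ S t (suc j)) ∸ S t j       ≡⟨ cong (λ k → (k ⊓ S t (suc j)) ∸ S t j) total ⟩
        (S t n ⊓ S t (suc j)) ∸ S t j                        ≡⟨ cong (_∸ S t j) (m≥n⇒m⊓n≡n (S-mono t j<n)) ⟩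
        S t (suc j) ∸ S t j                                  ≡⟨ m+n∸m≡n (S t j) (t (suc j)) ⟩
        t (suc j)                                            ∎
        where open ≡-Reasoning

      -- A ball thrown on turn j + 1 has rank < S t (j + 1) ≤ |L ∩ [1, S s (j + 1)]|,
      -- so it is held by then.
      thrown-held : ∀ j → suc j ≤ n → ∀ b → b ∈ Th (suc j) → 1 ≤ b × b ≤ S s (suc j)
      thrown-held j j<n b b∈ with thrown⁻ j b b∈
      ... | _ , Lb , _ , rank< with b | b ≤? S s (suc j)
      ...   | zero  | _ = ⊥-elim (true≢false Lb refl)
      ...   | suc _ | yes b≤ = s≤s z≤n , b≤
      ...   | suc x | no b≰ = ⊥-elim (<⇒≱ rank< (≤-trans (proj₂ ballot (suc j) j<n)
                (subst (_≤ count (ball L) (suc x)) (count-ball L (S s (suc j))) (count-mono (ball L) (≰⇒> b≰)))))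

      thrown-fresh : ∀ j b → b ∈ Th (suc j) → ∀ i → 1 ≤ i → i < suc j → ¬ (b ∈ Th i)
      thrown-fresh j b b∈ (suc i) _ i<j b∈' with thrown⁻ j b b∈ | thrown⁻ i b b∈'
      ... | _ , _ , lo , _ | _ , _ , _ , hi = <⇒≱ hi (≤-trans (S-mono t (≤-pred i<j)) lo)

      valid : ValidRun s t n Th
      valid (suc j) _ j<n = members-unique (turnOf j) (suc m) , length-turn j j<n ,
        λ b b∈ → thrown-held j j<n b b∈ , thrown-fresh j b b∈

      -- Every lawn ball has rank < S t n, so some turn throws it.
      lands : ∀ (x : Fin m) → (x ∈ˢ L) ⇔ (∃ λ i → 1 ≤ i × i ≤ n × suc (toℕ x) ∈ Th i)
      lands x = mk⇔ thrown-at-some-turn on-lawn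
        where
        thrown-at-some-turn : x ∈ˢ L → ∃ λ i → 1 ≤ i × i ≤ n × suc (toℕ x) ∈ Th i
        thrown-at-some-turn x∈L with S-locate t n (count (ball L) (suc (toℕ x)))
          (subst (count (ball L) (suc (toℕ x)) <_) total (count-< (ball L) (ball⁺ L x x∈L) (s≤s (toℕ<n x))))
        ... | j , j<n , lo , hi = suc j , s≤s z≤n , j<n ,
          members⁺ (turnOf j) (suc m) (s≤s (toℕ<n x)) (window⁺ (ball L) _ _ _ (ball⁺ L x x∈L) lo hi)
        on-lawn : (∃ λ i → 1 ≤ i × i ≤ n × suc (toℕ x) ∈ Th i) → x ∈ˢ L
        on-lawn (suc j , _ , _ , b∈) = from (∈⇔bit L x) (proj₁ (proj₂ (thrown⁻ j _ b∈)))

    ballot⇔possible : ∀ L → IsBallot L ⇔ PossibleLawn s t n L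
    ballot⇔possible L = mk⇔ (λ ballot → ToRun.Th L ballot , ToRun.valid L ballot , ToRun.lands L ballot)
                            (λ { (Th , run , lawn) → FromRun.isBallot L Th run lawn })

module Density (s t : ℕ → ℕ) (n : ℕ)
  (t-pos : ∀ i → 1 ≤ i → 1 ≤ t i) (t<s : ∀ i → 1 ≤ i → t i < s i) where
  open Counting
  open import Data.Nat
  open import Data.Nat.Properties
  open import Data.Fin using (Fin; toℕ) renaming (zero to fzero; suc to fsuc)
  open import Data.Vec using (tabulate; sum)
  open import Data.Vec.Properties using (tabulate-cong)
  open import Relation.Binary.PropositionalEquality
  open import Relation.Nullary using (yes; no; contradiction)
  open import Algebra.Properties.CommutativeSemigroup +-commutativeSemigroup using (interchange)

  u : ℕ → ℕ
  u i = s i ∸ t i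

  S-split : ∀ i → S s i ≡ S t i + S u i
  S-split zero    = refl
  S-split (suc i) = begin
    S s i + s (suc i)                         ≡⟨ cong₂ _+_ (S-split i) (sym (m+[n∸m]≡n (<⇒≤ (t<s (suc i) (s≤s z≤n))))) ⟩
    (S t i + S u i) + (t (suc i) + u (suc i)) ≡⟨ interchange (S t i) (S u i) (t (suc i)) (u (suc i)) ⟩
    (S t i + t (suc i)) + (S u i + u (suc i)) ∎
    where open ≡-Reasoning

  top : ℕ → ℕ
  top zero    = 1
  top (suc c) = t (suc c)

  bottom : ℕ → ℕ
  bottom c with c ≟ n
  ... | yes _ = 1
  ... | no  _ = u (suc c)

  rowDensity : Fin 2 → ℕ → ℕ
  rowDensity fzero        = top
  rowDensity (fsuc fzero) = bottom

  ρ≡rowDensity : ∀ r (c : Fin (suc n)) → ρ s t n r c ≡ rowDensity r (toℕ c)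
  ρ≡rowDensity fzero        fzero    = refl
  ρ≡rowDensity fzero        (fsuc c) = refl
  ρ≡rowDensity (fsuc fzero) c with toℕ c ≟ n
  ... | yes _ = refl
  ... | no  _ = refl

  rowDensity-pos : ∀ r c → c ≤ n → 1 ≤ rowDensity r c
  rowDensity-pos fzero        zero    _ = ≤-refl
  rowDensity-pos fzero        (suc c) _ = t-pos (suc c) (s≤s z≤n)
  rowDensity-pos (fsuc fzero) c       _ with c ≟ n
  ... | yes _ = ≤-refl
  ... | no  _ = m<n⇒0<n∸m (t<s (suc c) (s≤s z≤n))

  -- Block boundaries: the top row starts with the extra entry 1, the
  -- bottom row ends with one.
  top-boundary : ∀ c → sumTo top (suc c) ≡ suc (S t c)
  top-boundary zero    = refl
  top-boundary (suc c) = cong (_+ t (suc c)) (top-boundary c)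

  bottom-boundary : ∀ c → c ≤ n → sumTo bottom c ≡ S u c
  bottom-boundary zero    _ = refl
  bottom-boundary (suc c) c<n with c ≟ n
  ... | yes refl = contradiction c<n (<-irrefl refl)
  ... | no  _    = cong (_+ u (suc c)) (bottom-boundary c (<⇒≤ c<n))

  bottom-boundary-end : sumTo bottom (suc n) ≡ suc (S u n)
  bottom-boundary-end with n ≟ n
  ... | yes _ = trans (cong (_+ 1) (bottom-boundary n ≤-refl)) (+-comm (S u n) 1)
  ... | no n≢n = contradiction refl n≢n

  m : ℕ
  m = S s n

  N : ℕ
  N = Total (ρ s t n)

  -- Besides the S s n balls, the tableau holds the two extra entries.
  N≡2+m : N ≡ suc (suc m)
  N≡2+m = begin
    N                                              ≡⟨ cong₂ _+_ (row-sum fzero) (cong (_+ 0) (row-sum (fsuc fzero))) ⟩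
    sumTo top (suc n) + (sumTo bottom (suc n) + 0) ≡⟨ cong₂ _+_ (top-boundary n) (trans (+-identityʳ _) bottom-boundary-end) ⟩
    suc (S t n) + suc (S u n)                      ≡⟨ cong suc (+-suc (S t n) (S u n)) ⟩
    suc (suc (S t n + S u n))                      ≡⟨ cong (λ k → suc (suc k)) (sym (S-split n)) ⟩
    suc (suc m)                                    ∎
    where
    open ≡-Reasoning
    row-sum : ∀ r → sum (tabulate (λ c → ρ s t n r c)) ≡ sumTo (rowDensity r) (suc n)
    row-sum r = trans (cong sum (tabulate-cong (ρ≡rowDensity r))) (sum-tabulate (suc n) (rowDensity r))

  top-start≤ : ∀ i → sumTo top i ≤ S t i
  top-start≤ zero    = z≤n
  top-start≤ (suc i) = subst (_≤ S t (suc i)) (sym (top-boundary i))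
    (subst (_≤ S t i + t (suc i)) (+-comm (S t i) 1) (+-monoʳ-≤ (S t i) (t-pos (suc i) (s≤s z≤n))))

module Fillings where
  open Bits
  open import Data.Nat
  open import Data.Nat.Properties using (≤-pred)
  open import Data.Bool using (Bool; true)
  open import Data.Fin using (Fin; toℕ; fromℕ<) renaming (zero to fzero; suc to fsuc)
  open import Data.Fin.Properties using (toℕ-fromℕ<; toℕ<n; toℕ-injective; toℕ-inject₁)
  open import Data.Fin.Subset using (∣_∣) renaming (_∈_ to _∈ˢ_)
  open import Data.Vec using (lookup; tabulate)
  open import Data.Vec.Properties using (lookup∘tabulate; tabulate∘lookup; tabulate-cong)
  open import Relation.Binary.PropositionalEquality
  open import Data.Product using (∃; _×_; _,_; proj₁; proj₂)
  open Counting using (count; count-ext)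
  open import Function.Bundles using (_⇔_; mk⇔; Equivalence)
  open Equivalence

  module _ {n N : ℕ} where

    fromCells : (Fin 2 → ℕ → ℕ → Bool) → Filling n N
    fromCells D = tabulate λ r → tabulate λ c → tabulate λ x → D r (toℕ c) (toℕ x)

    cell-fromCells : ∀ D r c → cell (fromCells D) r c ≡ tabulate (λ x → D r (toℕ c) (toℕ x))
    cell-fromCells D r c =
      trans (cong (λ row → lookup row c) (lookup∘tabulate (λ r → tabulate λ c → tabulate λ x → D r (toℕ c) (toℕ x)) r))
            (lookup∘tabulate (λ c → tabulate {n = N} λ x → D r (toℕ c) (toℕ x)) c)

    ∈-fromCells : ∀ D r c (x : Fin N) → (x ∈ˢ cell (fromCells D) r c) ⇔ (D r (toℕ c) (toℕ x) ≡ true)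
    ∈-fromCells D r c x = mk⇔
      (λ x∈ → trans (sym (bit-fromCells D r c (toℕ x) (toℕ<n x))) (to (∈⇔bit _ x) x∈))
      (λ Dx → from (∈⇔bit _ x) (trans (bit-fromCells D r c (toℕ x) (toℕ<n x)) Dx))
      where
      bit-fromCells : ∀ D r c p → p < N → bit (cell (fromCells D) r c) p ≡ D r (toℕ c) p
      bit-fromCells D r c p p<N =
        trans (cong (λ v → bit v p) (cell-fromCells D r c)) (bit-tabulate {N} (D r (toℕ c)) p p<N)

    cells : Filling n N → Fin 2 → ℕ → ℕ → Bool
    cells T r = bits (lookup T r)

    cells-cell : ∀ T r (c : Fin (suc n)) p → cells T r (toℕ c) p ≡ bit (cell T r c) p
    cells-cell T r = bits-lookup (lookup T r)

    fromCells-cells : ∀ D T → (∀ r c p → c ≤ n → p < N → D r c p ≡ cells T r c p) → fromCells D ≡ T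
    fromCells-cells D T same =
      trans (tabulate-cong λ r → trans (tabulate-cong λ c → trans (tabulate-cong λ x → entry r c x)
              (tabulate∘lookup (cell T r c))) (tabulate∘lookup (lookup T r))) (tabulate∘lookup T)
      where
      entry : ∀ r c x → D r (toℕ c) (toℕ x) ≡ lookup (cell T r c) x
      entry r c x = trans (same r (toℕ c) (toℕ x) (≤-pred (toℕ<n c)) (toℕ<n x))
                          (trans (cells-cell T r c (toℕ x)) (bit-lookup (cell T r c) x))

    cells-fromCells : ∀ D r c p → c ≤ n → p < N → cells (fromCells D) r c p ≡ D r c p
    cells-fromCells D r c p c≤n p<N = begin
      cells (fromCells D) r c p               ≡⟨ cong (λ k → cells (fromCells D) r k p) (sym (toℕ-fromℕ< (s≤s c≤n))) ⟩
      cells (fromCells D) r (toℕ c') p        ≡⟨ cells-cell (fromCells D) r c' p ⟩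
      bit (cell (fromCells D) r c') p         ≡⟨ cong (λ v → bit v p) (cell-fromCells D r c') ⟩
      bit (tabulate {n = N} (λ x → D r (toℕ c') (toℕ x))) p ≡⟨ bit-tabulate {N} (D r (toℕ c')) p p<N ⟩
      D r (toℕ c') p                          ≡⟨ cong (λ k → D r k p) (toℕ-fromℕ< (s≤s c≤n)) ⟩
      D r c p                                 ∎
      where
      open ≡-Reasoning
      c' = fromℕ< (s≤s c≤n)

    cells⁻ : ∀ T r c p → cells T r c p ≡ true →
      ∃ λ (c' : Fin (suc n)) → ∃ λ (x : Fin N) → toℕ c' ≡ c × toℕ x ≡ p × x ∈ˢ cell T r c'
    cells⁻ T r c p Tcp with bits-bound (lookup T r) c p Tcp
    ... | c<1+n , p<N = c' , x , toℕ-fromℕ< c<1+n , toℕ-fromℕ< p<N ,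
          from (∈⇔bit (cell T r c') x) (trans (sym (cells-cell T r c' (toℕ x)))
            (subst₂ (λ c p → cells T r c p ≡ true) (sym (toℕ-fromℕ< c<1+n)) (sym (toℕ-fromℕ< p<N)) Tcp))
      where
      c' = fromℕ< c<1+n
      x = fromℕ< p<N

    cells⁺ : ∀ T r (c : Fin (suc n)) (x : Fin N) → x ∈ˢ cell T r c → cells T r (toℕ c) (toℕ x) ≡ true
    cells⁺ T r c x x∈ = trans (cells-cell T r c (toℕ x)) (to (∈⇔bit (cell T r c) x) x∈)

    cells-bound : ∀ T r c p → cells T r c p ≡ true → p < N
    cells-bound T r c p Tcp = proj₂ (bits-bound (lookup T r) c p Tcp)

  module SVTCells {n : ℕ} (ρ' : Fin 2 → Fin (suc n) → ℕ) (T : Filling n (Total ρ')) (svt : IsSVT ρ' T) where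

    private
      N = Total ρ'
      D = cells T

    size : ∀ r (c : Fin (suc n)) → count (D r (toℕ c)) N ≡ ρ' r c
    size r c = begin
      count (D r (toℕ c)) N        ≡⟨ count-ext _ _ N (λ p _ → cells-cell T r c p) ⟩
      count (bit (cell T r c)) N   ≡⟨ sym (∣∣≡count (cell T r c)) ⟩
      ∣ cell T r c ∣               ≡⟨ proj₁ svt r c ⟩
      ρ' r c                       ∎
      where open ≡-Reasoning

    covered : ∀ p → p < N → ∃ λ r → ∃ λ c → c ≤ n × D r c p ≡ true
    covered p p<N with proj₁ (proj₂ svt) (fromℕ< p<N)
    ... | r , c , x∈ =
      r , toℕ c , ≤-pred (toℕ<n c) , subst (λ p → D r (toℕ c) p ≡ true) (toℕ-fromℕ< p<N) (cells⁺ T r c _ x∈)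

    disjoint : ∀ r r' c c' p → D r c p ≡ true → D r' c' p ≡ true → r ≡ r' × c ≡ c'
    disjoint r r' c c' p Dp Dp' with cells⁻ T r c p Dp | cells⁻ T r' c' p Dp'
    ... | c₁ , x₁ , refl , refl , x₁∈ | c₂ , x₂ , refl , x₂≡x₁ , x₂∈
          with proj₁ (proj₂ (proj₂ svt)) x₁ r c₁ r' c₂ x₁∈
                 (subst (λ x → x ∈ˢ cell T r' c₂) (toℕ-injective x₂≡x₁) x₂∈)
    ...   | r≡r' , refl = r≡r' , refl

    row-increasing : ∀ r c p q → c < n → D r c p ≡ true → D r (suc c) q ≡ true → p < q
    row-increasing r c p q c<n Dp Dq with cells⁻ T r c p Dp | cells⁻ T r (suc c) q Dq
    ... | c₁ , x , c₁≡c , refl , x∈ | c₂ , y , c₂≡1+c , refl , y∈ =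
      proj₁ (proj₂ (proj₂ (proj₂ svt))) r j x y
        (subst (λ c → x ∈ˢ cell T r c) (toℕ-injective (trans c₁≡c (sym (trans (toℕ-inject₁ j) (toℕ-fromℕ< c<n))))) x∈)
        (subst (λ c → y ∈ˢ cell T r c) (toℕ-injective (trans c₂≡1+c (sym (cong suc (toℕ-fromℕ< c<n))))) y∈)
      where
      j = fromℕ< c<n

    column-increasing : ∀ c p q → D fzero c p ≡ true → D (fsuc fzero) c q ≡ true → p < q
    column-increasing c p q Dp Dq with cells⁻ T fzero c p Dp | cells⁻ T (fsuc fzero) c q Dq
    ... | c₁ , x , refl , refl , x∈ | c₂ , y , c₂≡c₁ , refl , y∈ =
      proj₂ (proj₂ (proj₂ (proj₂ svt))) c₁ x y x∈
        (subst (λ c → y ∈ˢ cell T (fsuc fzero) c) (toℕ-injective c₂≡c₁) y∈)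

module Bijection (s t : ℕ → ℕ) (n : ℕ)
  (t-pos : ∀ i → 1 ≤ i → 1 ≤ t i) (t<s : ∀ i → 1 ≤ i → t i < s i) where
  open Counting
  open Bits
  open Blocks
  open Tennis
  open Fillings
  open import Data.Nat
  open import Data.Nat.Properties
  open import Data.Bool using (Bool; true; false; _∧_; _∨_; not)
  open import Data.Fin using (Fin; toℕ; fromℕ<; inject₁) renaming (zero to fzero; suc to fsuc)
  open import Data.Fin.Properties using (toℕ<n; toℕ-fromℕ<; toℕ-injective; toℕ-inject₁)
  open import Data.Fin.Subset using (Subset; ∣_∣) renaming (_∈_ to _∈ˢ_)
  open import Data.Vec using (tabulate; lookup)
  open import Data.Vec.Properties using (tabulate-cong; tabulate∘lookup)
  open import Data.Product using (∃; _×_; _,_; proj₁; proj₂)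
  open import Data.Sum using (inj₁; inj₂)
  open import Data.Empty using (⊥; ⊥-elim)
  open import Relation.Binary.PropositionalEquality
  open import Relation.Nullary using (does; yes; no)
  open import Relation.Nullary.Decidable using (dec-true; dec-false)
  open import Data.Bool.Properties using (∧-zeroʳ)
  open import Function using (_$_)
  open import Function.Bundles using (Equivalence)
  open Equivalence

  open Density s t n t-pos t<s
  open Ballot s t n using (IsBallot)
  module Row' (r : Fin 2) = Row n (rowDensity r)

  Lawn : Set
  Lawn = Subset m

  Tableau : Set
  Tableau = Filling n N

  topRow : Lawn → ℕ → Bool
  topRow L zero    = true
  topRow L (suc x) = bit L x

  bottomRow : Lawn → ℕ → Bool
  bottomRow L p = not (topRow L p) ∧ does (p <? N)

  rowSet : Lawn → Fin 2 → ℕ → Bool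
  rowSet L fzero        = topRow L
  rowSet L (fsuc fzero) = bottomRow L

  rankCells : Lawn → Fin 2 → ℕ → ℕ → Bool
  rankCells L r = Row'.block r (rowSet L r)

  tableau : Lawn → Tableau
  tableau L = fromCells (rankCells L)

  lawnOf : Tableau → Lawn
  lawnOf T = tabulate λ x → anyBelow (cells T fzero) (suc n) (suc (toℕ x))

  topRow-bound : ∀ L p → topRow L p ≡ true → p < N
  topRow-bound L zero    _   = subst (0 <_) (sym N≡2+m) (s≤s z≤n)
  topRow-bound L (suc x) Lx = subst (suc x <_) (sym N≡2+m) (s≤s (m<n⇒m<1+n (bit-bound L x Lx)))

  rows-disjoint : ∀ L p → topRow L p ≡ true → bottomRow L p ≡ true → ⊥
  rows-disjoint L p in-top in-bottom rewrite in-top = true≢false in-bottom refl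

  rows-partition : ∀ L P → P ≤ N → count (topRow L) P + count (bottomRow L) P ≡ P
  rows-partition L P P≤N = count-partition (topRow L) (bottomRow L) P (rows-disjoint L) cover
    where
    cover : ∀ p → p < P → (topRow L p ∨ bottomRow L p) ≡ true
    cover p p<P with topRow L p
    ... | true  = refl
    ... | false = dec-true (p <? N) (<-≤-trans p<P P≤N)

  count-topRow : ∀ L k → count (topRow L) (suc k) ≡ suc (count (bit L) k)
  count-topRow L = count-shift (topRow L)

  module ToTableau (L : Lawn) (ballot : IsBallot L) where

    topRow-total : count (topRow L) N ≡ sumTo top (suc n)
    topRow-total = begin
      count (topRow L) N                ≡⟨ cong (count (topRow L)) N≡2+m ⟩
      count (topRow L) (suc (suc m))    ≡⟨ count-false (topRow L) (suc m) (bit-beyond L m ≤-refl) ⟩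
      count (topRow L) (suc m)          ≡⟨ count-topRow L m ⟩
      suc (count (bit L) m)             ≡⟨ cong suc (proj₁ ballot) ⟩
      suc (S t n)                       ≡⟨ sym (top-boundary n) ⟩
      sumTo top (suc n)                 ∎
      where open ≡-Reasoning

    bottomRow-total : count (bottomRow L) N ≡ sumTo bottom (suc n)
    bottomRow-total = +-cancelˡ-≡ (count (topRow L) N) _ _ (begin
      count (topRow L) N + count (bottomRow L) N   ≡⟨ rows-partition L N ≤-refl ⟩
      N                                            ≡⟨ N≡2+m ⟩
      suc (suc m)                                  ≡⟨ cong (λ k → suc (suc k)) (S-split n) ⟩
      suc (suc (S t n + S u n))                    ≡⟨ cong suc (sym (+-suc (S t n) (S u n))) ⟩
      suc (S t n) + suc (S u n)                    ≡⟨ sym (cong₂ _+_ (trans topRow-total (top-boundary n)) bottom-boundary-end) ⟩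
      count (topRow L) N + sumTo bottom (suc n)    ∎)
      where open ≡-Reasoning

    rowSet-total : ∀ r → count (rowSet L r) N ≡ Row'.B r (suc n)
    rowSet-total fzero        = topRow-total
    rowSet-total (fsuc fzero) = bottomRow-total

    -- The ballot inequality at turn c separates the two cells of column c
    -- by P = S s c + 1: the top cell lies before P, the bottom cell after.
    ballot-column : ∀ c p q → c ≤ n → Row'.block fzero (topRow L) c p ≡ true →
      Row'.block (fsuc fzero) (bottomRow L) c q ≡ true → p < q
    ballot-column c p q c≤n in-top in-bottom
      with Row'.block⁻ fzero (topRow L) c p in-top | Row'.block⁻ (fsuc fzero) (bottomRow L) c q in-bottom
    ... | _ , _ , top-rank< | bottom-q , bottom-rank≥ , _ = <-≤-trans p<P P≤q
      where
      P = suc (S s c)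
      P≤N : P ≤ N
      P≤N = subst (P ≤_) (sym N≡2+m) (m≤n⇒m≤1+n (s≤s (S-mono s c≤n)))
      ballot-at : suc (S t c) ≤ count (topRow L) P
      ballot-at = subst (suc (S t c) ≤_) (sym (count-topRow L (S s c))) (s≤s (proj₂ ballot c c≤n))
      bottom-at : count (bottomRow L) P ≤ S u c
      bottom-at = +-cancelˡ-≤ (suc (S t c)) _ _ (≤-trans (+-monoˡ-≤ _ ballot-at)
        (≤-reflexive (trans (rows-partition L P P≤N) (cong suc (S-split c)))))
      p<P : p < P
      p<P = rank<⇒< (topRow L) (<-≤-trans (subst (count (topRow L) p <_) (top-boundary c) top-rank<) ballot-at)
      P≤q : P ≤ q
      P≤q = rank≥⇒≥ (bottomRow L) bottom-q
        (≤-trans bottom-at (subst (_≤ count (bottomRow L) q) (bottom-boundary c c≤n) bottom-rank≥))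

    in-block : ∀ r c x → x ∈ˢ cell (tableau L) r c → Row'.block r (rowSet L r) (toℕ c) (toℕ x) ≡ true
    in-block r c x = to (∈-fromCells (rankCells L) r c x)

    sizes : ∀ r c → ∣ cell (tableau L) r c ∣ ≡ ρ s t n r c
    sizes r c = begin
      ∣ cell (tableau L) r c ∣                                       ≡⟨ cong ∣_∣ (cell-fromCells (rankCells L) r c) ⟩
      ∣ tabulate {n = N} (λ x → rankCells L r (toℕ c) (toℕ x)) ∣     ≡⟨ ∣tabulate∣ {N} (rankCells L r (toℕ c)) ⟩
      count (rankCells L r (toℕ c)) N                                ≡⟨ Row'.block-size r (rowSet L r) N (rowSet-total r)
                                                                                            (toℕ c) (≤-pred (toℕ<n c)) ⟩
      rowDensity r (toℕ c)                                           ≡⟨ sym (ρ≡rowDensity r c) ⟩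
      ρ s t n r c                                                    ∎
      where open ≡-Reasoning

    in-some-row : ∀ (x : Fin N) → ∃ λ r → rowSet L r (toℕ x) ≡ true
    in-some-row x with bool-split (topRow L (toℕ x))
    ... | inj₁ in-top = fzero , in-top
    ... | inj₂ ¬top   = fsuc fzero , ∧-true (cong not ¬top) (dec-true (toℕ x <? N) (toℕ<n x))

    cover : ∀ x → ∃ λ r → ∃ λ c → x ∈ˢ cell (tableau L) r c
    cover x with in-some-row x
    ... | r , in-r with Row'.block-exists r (rowSet L r) (toℕ x) in-r
                          (subst (count (rowSet L r) (toℕ x) <_) (rowSet-total r) (count-< (rowSet L r) in-r (toℕ<n x)))
    ...   | c , c≤n , in-c = r , fromℕ< (s≤s c≤n) , from (∈-fromCells (rankCells L) r _ x)
            (subst (λ c → rankCells L r c (toℕ x) ≡ true) (sym (toℕ-fromℕ< (s≤s c≤n))) in-c)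

    rowSets-disjoint : ∀ r r' p → rowSet L r p ≡ true → rowSet L r' p ≡ true → r ≡ r'
    rowSets-disjoint fzero        fzero        _ _      _      = refl
    rowSets-disjoint (fsuc fzero) (fsuc fzero) _ _      _      = refl
    rowSets-disjoint fzero        (fsuc fzero) p top    bottom = ⊥-elim (rows-disjoint L p top bottom)
    rowSets-disjoint (fsuc fzero) fzero        p bottom top    = ⊥-elim (rows-disjoint L p top bottom)

    disjoint : ∀ x r c r' c' → x ∈ˢ cell (tableau L) r c → x ∈ˢ cell (tableau L) r' c' → r ≡ r' × c ≡ c'
    disjoint x r c r' c' x∈ x∈' = same-cell r' c' (in-block r c x x∈) (in-block r' c' x x∈')
      where
      p = toℕ x
      in-row : ∀ r c → rankCells L r (toℕ c) p ≡ true → rowSet L r p ≡ true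
      in-row r c in-c = proj₁ (Row'.block⁻ r (rowSet L r) (toℕ c) p in-c)
      same-cell : ∀ r' c' → rankCells L r (toℕ c) p ≡ true → rankCells L r' (toℕ c') p ≡ true → r ≡ r' × c ≡ c'
      same-cell r' c' in-c in-c' with rowSets-disjoint r r' p (in-row r c in-c) (in-row r' c' in-c')
      ... | refl = refl , toℕ-injective (Row'.block-unique r (rowSet L r) (toℕ c) (toℕ c') p in-c in-c')

    rows : ∀ r (j : Fin n) x y → x ∈ˢ cell (tableau L) r (inject₁ j) → y ∈ˢ cell (tableau L) r (fsuc j) → toℕ x < toℕ y
    rows r j x y x∈ y∈ = Row'.block-increasing r (rowSet L r) (toℕ j) (toℕ x) (toℕ y)
      (subst (λ c → rankCells L r c (toℕ x) ≡ true) (toℕ-inject₁ j) (in-block r _ x x∈)) (in-block r _ y y∈)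

    columns : ∀ c x y → x ∈ˢ cell (tableau L) fzero c → y ∈ˢ cell (tableau L) (fsuc fzero) c → toℕ x < toℕ y
    columns c x y x∈ y∈ =
      ballot-column (toℕ c) (toℕ x) (toℕ y) (≤-pred (toℕ<n c)) (in-block fzero c x x∈) (in-block (fsuc fzero) c y y∈)

    isSVT : IsSVT (ρ s t n) (tableau L)
    isSVT = sizes , cover , disjoint , rows , columns

    lawnOf-tableau : lawnOf (tableau L) ≡ L
    lawnOf-tableau = trans (tabulate-cong entry) (tabulate∘lookup L)
      where
      entry : ∀ x → anyBelow (cells (tableau L) fzero) (suc n) (suc (toℕ x)) ≡ lookup L x
      entry x = begin
        anyBelow (cells (tableau L) fzero) (suc n) p        ≡⟨ anyBelow-ext _ _ (suc n) p (λ c c<1+n →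
                                                                 cells-fromCells (rankCells L) fzero c p (≤-pred c<1+n) p<N) ⟩
        anyBelow (rankCells L fzero) (suc n) p              ≡⟨ Row'.blocks-cover fzero (topRow L) N topRow-total (topRow-bound L) p ⟩
        bit L (toℕ x)                                       ≡⟨ bit-lookup L x ⟩
        lookup L x                                          ∎
        where
        open ≡-Reasoning
        p = suc (toℕ x)
        p<N : p < N
        p<N = subst (p <_) (sym N≡2+m) (s≤s (m<n⇒m<1+n (toℕ<n x)))

  module FromTableau (T : Tableau) (svt : IsSVT (ρ s t n) T) where

    open SVTCells (ρ s t n) T svt

    D : Fin 2 → ℕ → ℕ → Bool
    D = cells T

    -- By rigidity, each row of T is its entries distributed by rank.
    size′ : ∀ r c → c ≤ n → count (D r c) N ≡ rowDensity r c
    size′ r c c≤n = begin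
      count (D r c) N              ≡⟨ cong (λ k → count (D r k) N) (sym (toℕ-fromℕ< (s≤s c≤n))) ⟩
      count (D r (toℕ c')) N       ≡⟨ size r c' ⟩
      ρ s t n r c'                 ≡⟨ ρ≡rowDensity r c' ⟩
      rowDensity r (toℕ c')        ≡⟨ cong (rowDensity r) (toℕ-fromℕ< (s≤s c≤n)) ⟩
      rowDensity r c               ∎
      where
      open ≡-Reasoning
      c' = fromℕ< (s≤s c≤n)

    module Rigid (r : Fin 2) = Row'.Rigidity r (D r) N (rowDensity-pos r) (size′ r) (cells-bound T r)
      (λ c c' p Dp Dp' → proj₂ (disjoint r r c c' p Dp Dp')) (row-increasing r)

    entries : Fin 2 → ℕ → Bool
    entries r = Rigid.entries r

    entries-bound : ∀ r p → entries r p ≡ true → p < N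
    entries-bound r p in-r with anyBelow⁻ (D r) (suc n) p in-r
    ... | c , _ , Dp = cells-bound T r c p Dp

    zero-on-top : entries fzero 0 ≡ true
    zero-on-top with covered 0 (subst (0 <_) (sym N≡2+m) (s≤s z≤n))
    ... | fzero , c , c≤n , D0 = anyBelow⁺ (D fzero) (suc n) c 0 (s≤s c≤n) D0
    ... | fsuc fzero , c , c≤n , D0 with Rigid.some-entry fzero c c≤n
    ...   | z , Dz = ⊥-elim (n≮0 (column-increasing c z 0 Dz D0))

    max-not-on-top : entries fzero (suc m) ≡ false
    max-not-on-top with bool-split (entries fzero (suc m))
    ... | inj₂ absent = absent
    ... | inj₁ present with anyBelow⁻ (D fzero) (suc n) (suc m) present
    ...   | c , c<1+n , Dmax with Rigid.some-entry (fsuc fzero) c (≤-pred c<1+n)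
    ...     | z , Dz = ⊥-elim (<⇒≱ (subst (z <_) N≡2+m (cells-bound T (fsuc fzero) c z Dz))
                                  (column-increasing c (suc m) z Dmax Dz))

    topRow-entries : ∀ p → topRow (lawnOf T) p ≡ entries fzero p
    topRow-entries zero = sym zero-on-top
    topRow-entries (suc x) with x <? m
    ... | yes x<m = bit-tabulate {m} (λ y → entries fzero (suc y)) x x<m
    ... | no x≮m = trans (bit-beyond (lawnOf T) x (≮⇒≥ x≮m)) (sym beyond)
      where
      beyond : entries fzero (suc x) ≡ false
      beyond with x ≟ m
      ... | yes refl = max-not-on-top
      ... | no x≢m with bool-split (entries fzero (suc x))
      ...   | inj₂ absent = absent
      ...   | inj₁ present = ⊥-elim (x≢m (≤-antisym
                (≤-pred (≤-pred (subst (suc x <_) N≡2+m (entries-bound fzero (suc x) present)))) (≮⇒≥ x≮m)))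

    rowSet-entries : ∀ r p → rowSet (lawnOf T) r p ≡ entries r p
    rowSet-entries fzero        = topRow-entries
    rowSet-entries (fsuc fzero) p rewrite topRow-entries p with p <? N
    ... | no p≮N rewrite dec-false (p <? N) p≮N with bool-split (entries (fsuc fzero) p)
    ...   | inj₁ present = ⊥-elim (p≮N (entries-bound (fsuc fzero) p present))
    ...   | inj₂ absent  = trans (∧-zeroʳ (not (entries fzero p))) (sym absent)
    rowSet-entries (fsuc fzero) p | yes p<N rewrite dec-true (p <? N) p<N with bool-split (entries fzero p)
    ... | inj₁ on-top rewrite on-top = sym (not-bottom on-top)
      where
      not-bottom : entries fzero p ≡ true → entries (fsuc fzero) p ≡ false
      not-bottom on-top with bool-split (entries (fsuc fzero) p)
      ... | inj₂ absent = absent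
      ... | inj₁ present with anyBelow⁻ (D fzero) (suc n) p on-top | anyBelow⁻ (D (fsuc fzero)) (suc n) p present
      ...   | c , _ , Dp | c' , _ , Dp' with proj₁ (disjoint fzero (fsuc fzero) c c' p Dp Dp')
      ...     | ()
    ... | inj₂ off-top rewrite off-top with covered p p<N
    ...   | fzero , c , c≤n , Dp = ⊥-elim (true≢false (anyBelow⁺ (D fzero) (suc n) c p (s≤s c≤n) Dp) off-top)
    ...   | fsuc fzero , c , c≤n , Dp = sym (anyBelow⁺ (D (fsuc fzero)) (suc n) c p (s≤s c≤n) Dp)

    tableau-lawnOf : tableau (lawnOf T) ≡ T
    tableau-lawnOf = fromCells-cells (rankCells (lawnOf T)) T same
      where
      same : ∀ r c p → c ≤ n → p < N → rankCells (lawnOf T) r c p ≡ D r c p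
      same r c p c≤n _ = trans (Row'.block-ext r (rowSet (lawnOf T) r) (entries r) c p (rowSet-entries r))
                               (sym (Rigid.cell≡block r c p c≤n))

    count-top : ∀ k → count (entries fzero) (suc k) ≡ suc (count (bit (lawnOf T)) k)
    count-top k = trans (count-ext _ _ (suc k) (λ p _ → sym (topRow-entries p))) (count-topRow (lawnOf T) k)

    top-total : count (entries fzero) N ≡ suc (S t n)
    top-total = trans (Rigid.total fzero) (top-boundary n)

    lawn-size : count (bit (lawnOf T)) m ≡ S t n
    lawn-size = suc-injective (begin
      suc (count (bit (lawnOf T)) m)        ≡⟨ sym (count-top m) ⟩
      count (entries fzero) (suc m)         ≡⟨ sym (count-false (entries fzero) (suc m) max-not-on-top) ⟩
      count (entries fzero) (suc (suc m))   ≡⟨ cong (count (entries fzero)) (sym N≡2+m) ⟩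
      count (entries fzero) N               ≡⟨ top-total ⟩
      suc (S t n)                           ∎)
      where open ≡-Reasoning

    rows-partition′ : ∀ P → P ≤ N → count (entries fzero) P + count (entries (fsuc fzero)) P ≡ P
    rows-partition′ P P≤N = trans (sym (cong₂ _+_ (same fzero) (same (fsuc fzero)))) (rows-partition (lawnOf T) P P≤N)
      where
      same : ∀ r → count (rowSet (lawnOf T) r) P ≡ count (entries r) P
      same r = count-ext _ _ P (λ p _ → rowSet-entries r p)

    top-rank-in-column : ∀ i x → i ≤ n → entries fzero x ≡ true → count (entries fzero) x ≡ S t i → D fzero i x ≡ true
    top-rank-in-column i x i≤n top-x rank-x = trans (Rigid.cell≡block fzero i x i≤n)
      (Row'.block⁺ fzero (entries fzero) i x top-x
        (subst (sumTo top i ≤_) (sym rank-x) (top-start≤ i))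
        (subst₂ _<_ (sym rank-x) (sym (top-boundary i)) ≤-refl))

    bottom-rank-in-column : ∀ i y → i ≤ n → entries (fsuc fzero) y ≡ true →
      count (entries (fsuc fzero)) y ≡ S u i → D (fsuc fzero) i y ≡ true
    bottom-rank-in-column i y i≤n bottom-y rank-y = trans (Rigid.cell≡block (fsuc fzero) i y i≤n)
      (Row'.block⁺ (fsuc fzero) (entries (fsuc fzero)) i y bottom-y
        (≤-reflexive (trans (bottom-boundary i i≤n) (sym rank-y)))
        (subst (_< sumTo bottom (suc i)) (trans (bottom-boundary i i≤n) (sym rank-y))
          (subst (_≤ sumTo bottom (suc i)) (+-comm (sumTo bottom i) 1)
            (+-monoʳ-≤ (sumTo bottom i) (rowDensity-pos (fsuc fzero) i i≤n)))))

    -- Column i of the tableau forces the ballot inequality at turn i: were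
    -- fewer than S t i lawn balls ≤ S s i, the top entry x of rank S t i
    -- would lie after the bottom entry y of rank S u i, both in column i.
    lawn-prefix : ∀ i → i ≤ n → S t i ≤ count (bit (lawnOf T)) (S s i)
    lawn-prefix i i≤n with S t i ≤? count (bit (lawnOf T)) (S s i)
    ... | yes ballot = ballot
    ... | no ¬ballot = ⊥-elim $ crossing
      (count-rank (entries fzero) N (S t i) (subst (S t i <_) (sym top-total) (s≤s (S-mono t i≤n))))
      (count-rank (entries (fsuc fzero)) P (S u i) bottom-at)
      where
      P = suc (S s i)
      P≤N : P ≤ N
      P≤N = subst (P ≤_) (sym N≡2+m) (m≤n⇒m≤1+n (s≤s (S-mono s i≤n)))
      top-at : count (entries fzero) P ≤ S t i
      top-at = subst (_≤ S t i) (sym (count-top (S s i))) (≰⇒> ¬ballot)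
      bottom-at : suc (S u i) ≤ count (entries (fsuc fzero)) P
      bottom-at = +-cancelˡ-≤ (S t i) _ _ (begin
        S t i + suc (S u i)                                       ≡⟨ +-suc (S t i) (S u i) ⟩
        suc (S t i + S u i)                                       ≡⟨ cong suc (sym (S-split i)) ⟩
        P                                                         ≡⟨ sym (rows-partition′ P P≤N) ⟩
        count (entries fzero) P + count (entries (fsuc fzero)) P  ≤⟨ +-monoˡ-≤ _ top-at ⟩
        S t i + count (entries (fsuc fzero)) P                    ∎)
        where open ≤-Reasoning
      crossing : (∃ λ x → x < N × entries fzero x ≡ true × count (entries fzero) x ≡ S t i) →
                 (∃ λ y → y < P × entries (fsuc fzero) y ≡ true × count (entries (fsuc fzero)) y ≡ S u i) → ⊥
      crossing (x , _ , top-x , rank-x) (y , y<P , bottom-y , rank-y) = <⇒≱ x<P P≤x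
        where
        x<P : x < P
        x<P = <-trans (column-increasing i x y (top-rank-in-column i x i≤n top-x rank-x)
                                                (bottom-rank-in-column i y i≤n bottom-y rank-y)) y<P
        P≤x : P ≤ x
        P≤x = rank≥⇒≥ (entries fzero) top-x (subst (count (entries fzero) P ≤_) (sym rank-x) top-at)

    lawnOf-isBallot : IsBallot (lawnOf T)
    lawnOf-isBallot = lawn-size , lawn-prefix

-- The theorem: count the ballot lawns, then transport the count along
-- (1) to the possible lawns and along (2) to the tableaux.
theorem2p4 : (s t : ℕ → ℕ) →
    (∀ i → 1 ≤ i → 1 ≤ t i) → (∀ i → 1 ≤ i → t i < s i) →
    (n : ℕ) → 1 ≤ n →
    ∃ λ k → TennisCount s t n k × HasCard (IsSVT (ρ s t n)) k
theorem2p4 s t t-pos t<s n _ = k , lawns , tableaux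
  where
  open Cardinality
  open Tennis.Ballot s t n using (IsBallot; isBallot?; ballot⇔possible)
  open Bijection s t n t-pos t<s

  ballots : ∃ λ k → HasCard IsBallot k
  ballots = HasCard-decidable isBallot?

  k : ℕ
  k = proj₁ ballots

  lawns : TennisCount s t n k
  lawns = HasCard-⇔ ballot⇔possible (proj₂ ballots)

  tableaux : HasCard (IsSVT (ρ s t n)) k
  tableaux = HasCard-bij tableau lawnOf ToTableau.isSVT FromTableau.lawnOf-isBallot
    ToTableau.lawnOf-tableau FromTableau.tableau-lawnOf (proj₂ ballots)
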